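{- The functor $\Pi_1\colon\mathsf{Graph}\to\mathsf{Gpd}$ is strict monoidal (from $(\mathsf{Graph},\square,I_0)$ to $(\mathsf{Gpd},\times,\ast)$). In particular, for any two graphs $X$ and $Y$, the functors $\Psi_{X,Y}\colon\Pi_1(X\square Y)\to\Pi_1X\times\Pi_1Y$ and $\Phi_{X,Y}\colon\Pi_1X\times\Pi_1Y\to\Pi_1(X\square Y)$ are inverse to each other.
   Context: Graphs are simple undirected graphs without loops; a graph map $f\colon X\to Y$ is a vertex function such that adjacent vertices go to equal or adjacent vertices; $\mathsf{Graph}$ is the resulting category and $\mathsf{Gpd}$ the category of small groupoids. $I_n$ ($n\in\mathbb{N}$) has vertices $0,\dots,n$ and edges $i\sim i+1$. The box product $X\square Y$ has vertex set $V(X)\times V(Y)$, with $(x,y)\sim(x',y')$ iff either $x\sim x'$ and $y=y'$, or $x=x'$ and $y\sim y'$; $I_0$ is its unit. A path $\gamma\colon x\rightsquigarrow x'$ of length $n$ is a graph map $\gamma\colon I_n\to X$ with $\gamma(0)=x,\gamma(n)=x'$; concatenation $\gamma\ast\sigma$ of $\gamma$ (length $m$) and $\sigma\colon x'\rightsquigarrow x''$ (length $n$) is the path of length $m+n$ equal to $\gamma(i)$ for $i\le m$ and $\sigma(i-m)$ for $i\ge m$; the reverse is $\overline{\gamma}(i)=\gamma(n-i)$. A shrinking map is a surjective order-preserving graph map $I_m\to I_n$. $P_nX(x,x')$ is the graph whose vertices are paths of length $n$ from $x$ to $x'$, with $\gamma\sim\sigma$ iff $\gamma\ne\sigma$ and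 $\gamma(i)=\sigma(i)$ or $\gamma(i)\sim\sigma(i)$ for all $i$. $P_{\mathbb{N}}X(x,x')$ is the quotient of $\coprod_{n\in\mathbb{N}}P_nX(x,x')$ by the equivalence relation generated by $\gamma\sim\gamma\circ s$ for shrinking maps $s$ (quotient graph: classes as vertices, distinct classes adjacent iff some representatives are). $\pi_0$ denotes the set of path-components. The fundamental groupoid $\Pi_1X$ has objects the vertices of $X$, morphisms $\Pi_1X(x,x')=\pi_0P_{\mathbb{N}}X(x,x')$, composition $[\sigma]\circ[\gamma]=[\gamma\ast\sigma]$, inverses $[\overline\gamma]$; a graph map $f$ induces $[\gamma]\mapsto[f\circ\gamma]$. $\Psi_{X,Y}$ has components $\Pi_1$ of the projections $X\square Y\to X$, $X\square Y\to Y$, i.e. $[\gamma]\mapsto([\pi_X\gamma],[\pi_Y\gamma])$. $\Phi_{X,Y}$ sends a morphism $([\sigma],[\tau])\colon(x,y)\to(x',y')$ to $[(\sigma\square y)\ast(x'\square\tau)]$, where $(\sigma\square y)(i)=(\sigma(i),y)$ and $(x'\square\tau)(j)=(x',\tau(j))$. -}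

module Defs where

open import Level using (0ℓ)
open import Data.Nat using (ℕ; zero; suc)
open import Data.Nat.Properties using (suc-injective)
open import Data.Fin using (Fin; zero; suc; toℕ; inject₁; fromℕ; _≤_)
open import Data.Product using (Σ; ∃; _×_; _,_; proj₁; proj₂)
open import Data.Sum using (_⊎_; inj₁; inj₂)
open import Data.Empty using (⊥)
open import Relation.Nullary using (¬_)
open import Relation.Binary.PropositionalEquality
  using (_≡_; refl; sym; trans; cong)
open import Relation.Binary.Construct.Closure.Equivalence using (EqClosure)

record Graph : Set₁ where
  field
    V      : Set
    _~_    : V → V → Set
    ~-sym  : ∀ {x y} → x ~ y → y ~ x
    ~-irr  : ∀ {x} → ¬ (x ~ x)

open Graph public

_∋_≃_ : (X : Graph) → V X → V X → Set
X ∋ a ≃ b = a ≡ b ⊎ _~_ X a b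

record GraphMap (X Y : Graph) : Set where
  field
    fun  : V X → V Y
    pres : ∀ {a b} → _~_ X a b → Y ∋ fun a ≃ fun b

open GraphMap public

private
  n≢sn : ∀ {k : ℕ} → ¬ (suc k ≡ k)
  n≢sn {zero} ()
  n≢sn {suc k} e = n≢sn (suc-injective e)

I : ℕ → Graph
I n = record
  { V     = Fin (suc n)
  ; _~_   = λ a b → (suc (toℕ a) ≡ toℕ b) ⊎ (suc (toℕ b) ≡ toℕ a)
  ; ~-sym = λ { (inj₁ e) → inj₂ e ; (inj₂ e) → inj₁ e }
  ; ~-irr = λ { (inj₁ e) → n≢sn e ; (inj₂ e) → n≢sn e }
  }

_□_ : Graph → Graph → Graph
X □ Y = record
  { V     = V X × V Y
  ; _~_   = λ p q → (_~_ X (proj₁ p) (proj₁ q) × proj₂ p ≡ proj₂ q)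
                  ⊎ (proj₁ p ≡ proj₁ q × _~_ Y (proj₂ p) (proj₂ q))
  ; ~-sym = λ { (inj₁ (a , e)) → inj₁ (~-sym X a , sym e)
              ; (inj₂ (e , a)) → inj₂ (sym e , ~-sym Y a) }
  ; ~-irr = λ { (inj₁ (a , _)) → ~-irr X a ; (inj₂ (_ , a)) → ~-irr Y a }
  }

π₁ : (X Y : Graph) → GraphMap (X □ Y) X
π₁ X Y = record { fun = proj₁ ; pres = λ { (inj₁ (a , _)) → inj₂ a ; (inj₂ (e , _)) → inj₁ e } }

π₂ : (X Y : Graph) → GraphMap (X □ Y) Y
π₂ X Y = record { fun = proj₂ ; pres = λ { (inj₁ (_ , e)) → inj₁ e ; (inj₂ (_ , a)) → inj₂ a } }

-- Paths of length n from x to x' : graph maps I_n → X with given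
-- endpoints.  The graph-map condition is written out on the edges
-- i ~ i+1 of I_n (these are all the edges of I_n).

record Path (X : Graph) (n : ℕ) (x x' : V X) : Set where
  field
    at    : Fin (suc n) → V X
    step  : ∀ (i : Fin n) → X ∋ at (inject₁ i) ≃ at (suc i)
    start : at zero ≡ x
    end   : at (fromℕ n) ≡ x'

open Path public

-- Paths of arbitrary length (the vertices of ∐_n P_n X(x,x')).
Paths : (X : Graph) → V X → V X → Set
Paths X x x' = Σ ℕ λ n → Path X n x x'

record Shrink (m n : ℕ) : Set where
  field
    sh     : Fin (suc m) → Fin (suc n)
    sh-mon : ∀ {i j} → i ≤ j → sh i ≤ sh j
    sh-map : ∀ (i : Fin m) → I n ∋ sh (inject₁ i) ≃ sh (suc i)
    sh-sur : ∀ (j : Fin (suc n)) → ∃ λ i → sh i ≡ j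

open Shrink public

data Gen (X : Graph) {x x' : V X} : Paths X x x' → Paths X x x' → Set where
  shrink : ∀ {m n} (γ : Path X n x x') (δ : Path X m x x') (s : Shrink m n)
         → (∀ i → at δ i ≡ at γ (sh s i))
         → Gen X (n , γ) (m , δ)
  adjacent : ∀ {n} (γ σ : Path X n x x')
         → (∀ i → X ∋ at γ i ≃ at σ i)
         → Gen X (n , γ) (n , σ)

-- Two paths represent the same morphism of Π₁X(x,x') = π₀ P_ℕ X(x,x').
_⊢_≈_ : (X : Graph) {x x' : V X} → Paths X x x' → Paths X x x' → Set
X ⊢ p ≈ q = EqClosure (Gen X) p q

mapPath : ∀ {X Y : Graph} (f : GraphMap X Y) {n x x'}
        → Path X n x x' → Path Y n (fun f x) (fun f x')
mapPath {X} {Y} f γ = record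
  { at    = λ i → fun f (at γ i)
  ; step  = λ i → lemma (step γ i)
  ; start = cong (fun f) (start γ)
  ; end   = cong (fun f) (end γ)
  }
  where
  lemma : ∀ {a b} → X ∋ a ≃ b → Y ∋ fun f a ≃ fun f b
  lemma (inj₁ e) = inj₁ (cong (fun f) e)
  lemma (inj₂ a) = pres f a

mapPaths : ∀ {X Y : Graph} (f : GraphMap X Y) {x x'}
         → Paths X x x' → Paths Y (fun f x) (fun f x')
mapPaths f (n , γ) = n , mapPath f γ

-- Concatenation γ ∗ σ : equal to γ(i) for i ≤ m and σ(i-m) for i ≥ m.

cat : ∀ {A : Set} (m n : ℕ) → (Fin (suc m) → A) → (Fin (suc n) → A)
    → Fin (suc (m Data.Nat.+ n)) → A
cat zero    n f g zero    = f zero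
cat zero    n f g (suc i) = g (suc i)
cat (suc m) n f g zero    = f zero
cat (suc m) n f g (suc i) = cat m n (λ j → f (suc j)) g i

private
  cat-zero : ∀ {A : Set} m n (f : Fin (suc m) → A) g → cat m n f g zero ≡ f zero
  cat-zero zero    n f g = refl
  cat-zero (suc m) n f g = refl

  cat-end : ∀ {A : Set} m n (f : Fin (suc m) → A) g → f (fromℕ m) ≡ g zero
          → cat m n f g (fromℕ (m Data.Nat.+ n)) ≡ g (fromℕ n)
  cat-end zero zero    f g e = e
  cat-end zero (suc n) f g e = refl
  cat-end (suc m) n f g e = cat-end m n (λ j → f (suc j)) g e

  cat-step : ∀ (X : Graph) m n (f : Fin (suc m) → V X) (g : Fin (suc n) → V X)
           → (∀ (i : Fin m) → X ∋ f (inject₁ i) ≃ f (suc i))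
           → (∀ (i : Fin n) → X ∋ g (inject₁ i) ≃ g (suc i))
           → f (fromℕ m) ≡ g zero
           → ∀ (i : Fin (m Data.Nat.+ n))
           → X ∋ cat m n f g (inject₁ i) ≃ cat m n f g (suc i)
  cat-step X zero (suc n) f g sf sg e zero with sg zero
  ... | inj₁ e' = inj₁ (trans e e')
  ... | inj₂ a  rewrite e = inj₂ a
  cat-step X zero (suc n) f g sf sg e (suc i) = sg (suc i)
  cat-step X (suc m) n f g sf sg e zero
    rewrite cat-zero m n (λ j → f (suc j)) g = sf zero
  cat-step X (suc m) n f g sf sg e (suc i) =
    cat-step X m n (λ j → f (suc j)) g (λ j → sf (suc j)) sg e i

_∗_ : ∀ {X : Graph} {m n x x' x''} → Path X m x x' → Path X n x' x''
    → Path X (m Data.Nat.+ n) x x''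
_∗_ {X} {m} {n} γ σ = record
  { at    = cat m n (at γ) (at σ)
  ; step  = cat-step X m n (at γ) (at σ) (step γ) (step σ) e
  ; start = trans (cat-zero m n (at γ) (at σ)) (start γ)
  ; end   = trans (cat-end m n (at γ) (at σ) e) (end σ)
  }
  where e = trans (end γ) (sym (start σ))

_∗∗_ : ∀ {X : Graph} {x x' x''} → Paths X x x' → Paths X x' x'' → Paths X x x''
(m , γ) ∗∗ (n , σ) = (m Data.Nat.+ n) , (γ ∗ σ)

_□ʳ_ : (X : Graph) {Y : Graph} → V Y → GraphMap X (X □ Y)
(X □ʳ y) = record { fun = λ a → a , y ; pres = λ a → inj₂ (inj₁ (a , refl)) }

_□ˡ_ : {X : Graph} (Y : Graph) → V X → GraphMap Y (X □ Y)
(Y □ˡ x) = record { fun = λ b → x , b ; pres = λ b → inj₂ (inj₂ (refl , b)) }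

Ψ : (X Y : Graph) {x x' : V X} {y y' : V Y}
  → Paths (X □ Y) (x , y) (x' , y') → Paths X x x' × Paths Y y y'
Ψ X Y p = mapPaths (π₁ X Y) p , mapPaths (π₂ X Y) p

Φ : (X Y : Graph) {x x' : V X} {y y' : V Y}
  → Paths X x x' × Paths Y y y' → Paths (X □ Y) (x , y) (x' , y')
Φ X Y {x' = x'} {y = y} (σ , τ) =
  mapPaths (_□ʳ_ X {Y} y) σ ∗∗ mapPaths (_□ˡ_ {X} Y x') τ

-- A path of length n is read as the eventually constant sequence ℕ → V X
-- obtained by clamping indices to [0, n].  A shrinking then becomes a map
-- ℕ → ℕ fixing 0, hitting the top and moving by steps of 0 or 1, and
-- concatenation becomes splicing of sequences; in this form the generating
-- relation of Π₁ is visibly preserved by graph maps and by concatenation on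
-- either side, so Ψ and Φ are well defined.  The projections of
-- (σ □ y) ∗ (x' □ τ) are σ ∘ min(-, m) and τ ∘ (- ∸ m), reparametrisations
-- of σ and τ.  For a path k ↦ (a k , b k) of length n in X □ Y the paths
-- k ↦ (a k , b (min(j, k) + (k ∸ n))), 0 ≤ j ≤ n, are consecutively
-- adjacent; the first is (a □ y) ∗ (x' □ b) and the last is the path padded
-- by a constant tail.

module Submission where

open import Defs
open import Data.Empty using (⊥-elim)
open import Data.Fin using (Fin; zero; suc; toℕ; inject₁; fromℕ)
open import Data.Fin.Properties using (toℕ-inject₁; toℕ-fromℕ; toℕ<n; toℕ≤pred[n]; ≤̄⇒inject₁<)
open import Data.Nat using (ℕ; zero; suc; _+_; _∸_; _⊓_; _≤_; _<_; z≤n; s≤s; z<s; s≤s⁻¹)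
open import Data.Nat.Properties
open import Data.Product using (∃; _×_; _,_; proj₁; proj₂)
open import Data.Sum using (_⊎_; inj₁; inj₂)
open import Function using (id; _∘_)
open import Relation.Binary.PropositionalEquality
open import Relation.Binary.Construct.Closure.Equivalence using (gmap; return; symmetric; transitive)
open import Relation.Binary.Construct.Closure.ReflexiveTransitive using (ε)
open ≡-Reasoning

clamp : (n : ℕ) → ℕ → Fin (suc n)
clamp zero    _       = zero
clamp (suc n) zero    = zero
clamp (suc n) (suc k) = suc (clamp n k)

clamp-toℕ : ∀ n (i : Fin (suc n)) → clamp n (toℕ i) ≡ i
clamp-toℕ zero    zero    = refl
clamp-toℕ (suc n) zero    = refl
clamp-toℕ (suc n) (suc i) = cong suc (clamp-toℕ n i)

toℕ-clamp : ∀ {n k} → k ≤ n → toℕ (clamp n k) ≡ k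
toℕ-clamp {zero}  z≤n       = refl
toℕ-clamp {suc n} z≤n       = refl
toℕ-clamp {suc n} (s≤s k≤n) = cong suc (toℕ-clamp k≤n)

clamp-≥ : ∀ {n k} → n ≤ k → clamp n k ≡ fromℕ n
clamp-≥ {zero}  _         = refl
clamp-≥ {suc n} (s≤s n≤k) = cong suc (clamp-≥ n≤k)

clamp-inject₁ : ∀ {n k} → k ≤ n → clamp (suc n) k ≡ inject₁ (clamp n k)
clamp-inject₁ {zero}  z≤n       = refl
clamp-inject₁ {suc n} z≤n       = refl
clamp-inject₁ {suc n} (s≤s k≤n) = cong suc (clamp-inject₁ k≤n)

clamp-mono : ∀ n {a b} → a ≤ b → toℕ (clamp n a) ≤ toℕ (clamp n b)
clamp-mono zero    _         = z≤n
clamp-mono (suc n) z≤n       = z≤n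
clamp-mono (suc n) (s≤s a≤b) = s≤s (clamp-mono n a≤b)

data Cut (m : ℕ) : ℕ → Set where
  before : ∀ {k} → k < m → Cut m k
  after  : ∀ t → Cut m (m + t)

cut : ∀ m k → Cut m k
cut zero    k       = after k
cut (suc m) zero    = before z<s
cut (suc m) (suc k) with cut m k
... | before k<m = before (s≤s k<m)
... | after t    = after t

walk : ∀ {X n x x'} → Path X n x x' → ℕ → V X
walk {n = n} γ k = at γ (clamp n k)

module _ {X : Graph} {n : ℕ} {x x' : V X} (γ : Path X n x x') where

  walk-toℕ : ∀ i → walk γ (toℕ i) ≡ at γ i
  walk-toℕ i = cong (at γ) (clamp-toℕ n i)

  walk-zero : walk γ 0 ≡ x
  walk-zero = trans (walk-toℕ zero) (start γ)

  walk-≥ : ∀ {k} → n ≤ k → walk γ k ≡ x'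
  walk-≥ n≤k = trans (cong (at γ) (clamp-≥ n≤k)) (end γ)

  walk-⊓ : ∀ k → walk γ (k ⊓ n) ≡ walk γ k
  walk-⊓ k with ≤-<-connex k n
  ... | inj₁ k≤n = cong (walk γ) (m≤n⇒m⊓n≡m k≤n)
  ... | inj₂ n<k = trans (walk-≥ (≤-reflexive (sym (m≥n⇒m⊓n≡n (<⇒≤ n<k)))))
                         (sym (walk-≥ (<⇒≤ n<k)))

walk-step : ∀ {X n x x'} (γ : Path X n x x') k → X ∋ walk γ k ≃ walk γ (suc k)
walk-step {n = zero}  γ k = inj₁ refl
walk-step {X} {suc n} γ k with ≤-<-connex k n
... | inj₁ k≤n = subst (λ i → X ∋ at γ i ≃ walk γ (suc k)) (sym (clamp-inject₁ k≤n))
                       (step γ (clamp n k))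
... | inj₂ n<k = inj₁ (trans (walk-≥ γ n<k) (sym (walk-≥ γ (m≤n⇒m≤1+n n<k))))

fromWalk : ∀ {X x x'} n (w : ℕ → V X) → (∀ k → X ∋ w k ≃ w (suc k))
         → w 0 ≡ x → w n ≡ x' → Path X n x x'
fromWalk {X} n w w-step w-start w-end = record
  { at    = w ∘ toℕ
  ; step  = λ i → subst (λ k → X ∋ w k ≃ w (suc (toℕ i))) (sym (toℕ-inject₁ i)) (w-step (toℕ i))
  ; start = w-start
  ; end   = trans (cong w (toℕ-fromℕ n)) w-end
  }

≃-map : ∀ {X Y} (f : GraphMap X Y) {a b} → X ∋ a ≃ b → Y ∋ fun f a ≃ fun f b
≃-map f (inj₁ a≡b) = inj₁ (cong (fun f) a≡b)
≃-map f (inj₂ a~b) = pres f a~b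

splice : ∀ {A : Set} → ℕ → (ℕ → A) → (ℕ → A) → ℕ → A
splice zero    u v zero    = u zero
splice zero    u v (suc k) = v (suc k)
splice (suc m) u v zero    = u zero
splice (suc m) u v (suc k) = splice m (u ∘ suc) v k

splice-≤ : ∀ {A : Set} {m k} (u v : ℕ → A) → k ≤ m → splice m u v k ≡ u k
splice-≤ {m = zero}  u v z≤n       = refl
splice-≤ {m = suc m} u v z≤n       = refl
splice-≤ {m = suc m} u v (s≤s k≤m) = splice-≤ (u ∘ suc) v k≤m

splice-+ : ∀ {A : Set} m (u v : ℕ → A) → u m ≡ v 0 → ∀ t → splice m u v (m + t) ≡ v t
splice-+ zero    u v um≡v0 zero    = um≡v0
splice-+ zero    u v um≡v0 (suc t) = refl
splice-+ (suc m) u v um≡v0 t       = splice-+ m (u ∘ suc) v um≡v0 t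

splice-rel : ∀ {A B : Set} (R : A → B → Set) m {u v u' v'}
           → (∀ k → R (u k) (u' k)) → (∀ k → R (v k) (v' k))
           → ∀ k → R (splice m u v k) (splice m u' v' k)
splice-rel R zero    Ru Rv zero    = Ru zero
splice-rel R zero    Ru Rv (suc k) = Rv (suc k)
splice-rel R (suc m) Ru Rv zero    = Ru zero
splice-rel R (suc m) Ru Rv (suc k) = splice-rel R m (Ru ∘ suc) Rv k

cat-splice : ∀ {A : Set} m n (f : Fin (suc m) → A) (g : Fin (suc n) → A) i
           → cat m n f g i ≡ splice m (f ∘ clamp m) (g ∘ clamp n) (toℕ i)
cat-splice zero    n f g zero    = refl
cat-splice zero    n f g (suc i) = cong g (sym (clamp-toℕ n (suc i)))
cat-splice (suc m) n f g zero    = refl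
cat-splice (suc m) n f g (suc i) = cat-splice m n (f ∘ suc) g i

module _ {X : Graph} {m n : ℕ} {x x' x'' : V X} (γ : Path X m x x') (σ : Path X n x' x'') where

  at-∗ : ∀ i → at (γ ∗ σ) i ≡ splice m (walk γ) (walk σ) (toℕ i)
  at-∗ = cat-splice m n (at γ) (at σ)

  walk-∗ : ∀ {k} → k ≤ m + n → walk (γ ∗ σ) k ≡ splice m (walk γ) (walk σ) k
  walk-∗ {k} k≤m+n =
    trans (at-∗ (clamp (m + n) k)) (cong (splice m (walk γ) (walk σ)) (toℕ-clamp k≤m+n))

  walk-junction : walk γ m ≡ walk σ 0
  walk-junction = trans (walk-≥ γ ≤-refl) (sym (walk-zero σ))

UnitStep : ℕ → ℕ → Set
UnitStep a b = b ≡ a ⊎ b ≡ suc a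

UnitStep-+ : ∀ n {a b} → UnitStep a b → UnitStep (n + a) (n + b)
UnitStep-+ n (inj₁ b≡a)   = inj₁ (cong (n +_) b≡a)
UnitStep-+ n (inj₂ b≡1+a) = inj₂ (trans (cong (n +_) b≡1+a) (+-suc n _))

UnitStep⇒≃ : ∀ {n a b} → a ≤ n → b ≤ n → UnitStep a b → I n ∋ clamp n a ≃ clamp n b
UnitStep⇒≃ a≤n b≤n (inj₁ b≡a)   = inj₁ (cong (clamp _) (sym b≡a))
UnitStep⇒≃ a≤n b≤n (inj₂ b≡1+a) =
  inj₂ (inj₁ (trans (cong suc (toℕ-clamp a≤n)) (trans (sym b≡1+a) (sym (toℕ-clamp b≤n)))))

≃⇒UnitStep : ∀ {n} {a b : Fin (suc n)} → toℕ a ≤ toℕ b → I n ∋ a ≃ b → UnitStep (toℕ a) (toℕ b)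
≃⇒UnitStep a≤b (inj₁ refl)         = inj₁ refl
≃⇒UnitStep a≤b (inj₂ (inj₁ 1+a≡b)) = inj₂ (sym 1+a≡b)
≃⇒UnitStep a≤b (inj₂ (inj₂ 1+b≡a)) = ⊥-elim (1+n≰n (≤-trans (≤-reflexive 1+b≡a) a≤b))

record IsShrinking (m n : ℕ) (s : ℕ → ℕ) : Set where
  field
    zero↦zero  : s 0 ≡ 0
    top↦top    : s m ≡ n
    unit-steps : ∀ {k} → k < m → UnitStep (s k) (s (suc k))

open IsShrinking

module _ {m n : ℕ} {s : ℕ → ℕ} (S : IsShrinking m n s) where

  shrinking-step-≤ : ∀ {k} → k < m → s k ≤ s (suc k)
  shrinking-step-≤ k<m with unit-steps S k<m
  ... | inj₁ e = ≤-reflexive (sym e)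
  ... | inj₂ e = ≤-trans (n≤1+n _) (≤-reflexive (sym e))

  shrinking-mono : ∀ {k l} → k ≤ l → l ≤ m → s k ≤ s l
  shrinking-mono {l = zero}  z≤n     _    = ≤-refl
  shrinking-mono {l = suc l} k≤1+l 1+l≤m with m≤n⇒m<n∨m≡n k≤1+l
  ... | inj₁ k<1+l = ≤-trans (shrinking-mono (s≤s⁻¹ k<1+l) (<⇒≤ 1+l≤m)) (shrinking-step-≤ 1+l≤m)
  ... | inj₂ refl  = ≤-refl

  shrinking-bounded : ∀ {k} → k ≤ m → s k ≤ n
  shrinking-bounded {k} k≤m = subst (s k ≤_) (top↦top S) (shrinking-mono k≤m ≤-refl)

  shrinking-reaches : ∀ {l j} → l ≤ m → j ≤ s l → ∃ λ k → k ≤ l × s k ≡ j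
  shrinking-reaches {zero} _ j≤s0 =
    0 , z≤n , trans (zero↦zero S) (sym (n≤0⇒n≡0 (subst (_ ≤_) (zero↦zero S) j≤s0)))
  shrinking-reaches {suc l} {j} 1+l≤m j≤s[1+l] with ≤-<-connex j (s l)
  ... | inj₁ j≤sl with shrinking-reaches (<⇒≤ 1+l≤m) j≤sl
  ...   | k , k≤l , sk≡j = k , m≤n⇒m≤1+n k≤l , sk≡j
  shrinking-reaches {suc l} {j} 1+l≤m j≤s[1+l] | inj₂ sl<j with unit-steps S 1+l≤m
  ...   | inj₁ e = ⊥-elim (<-irrefl refl (<-≤-trans sl<j (≤-trans j≤s[1+l] (≤-reflexive e))))
  ...   | inj₂ e = suc l , ≤-refl , ≤-antisym (subst (_≤ j) (sym e) sl<j) j≤s[1+l]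

  shrinking-surjective : ∀ {j} → j ≤ n → ∃ λ k → k ≤ m × s k ≡ j
  shrinking-surjective j≤n = shrinking-reaches ≤-refl (subst (_ ≤_) (sym (top↦top S)) j≤n)

IsShrinking⇒Shrink : ∀ {m n s} → IsShrinking m n s → Shrink m n
IsShrinking⇒Shrink {m} {n} {s} S = record
  { sh     = λ i → clamp n (s (toℕ i))
  ; sh-mon = λ {i} {j} i≤j →
      subst₂ _≤_ (sym (toℕ-clamp (bounded i))) (sym (toℕ-clamp (bounded j)))
             (shrinking-mono S i≤j (toℕ≤pred[n] j))
  ; sh-map = λ i →
      subst (λ k → I n ∋ clamp n (s k) ≃ clamp n (s (suc (toℕ i)))) (sym (toℕ-inject₁ i))
            (UnitStep⇒≃ (shrinking-bounded S (<⇒≤ (toℕ<n i))) (shrinking-bounded S (toℕ<n i))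
                        (unit-steps S (toℕ<n i)))
  ; sh-sur = preimage
  }
  where
  bounded : ∀ (i : Fin (suc m)) → s (toℕ i) ≤ n
  bounded i = shrinking-bounded S (toℕ≤pred[n] i)

  preimage : ∀ j → ∃ λ i → clamp n (s (toℕ i)) ≡ j
  preimage j with shrinking-surjective S (toℕ≤pred[n] j)
  ... | k , k≤m , sk≡j =
    clamp m k , trans (cong (clamp n ∘ s) (toℕ-clamp k≤m))
                      (trans (cong (clamp n) sk≡j) (clamp-toℕ n j))

shℕ : ∀ {m n} → Shrink m n → ℕ → ℕ
shℕ {m} s k = toℕ (sh s (clamp m k))

shℕ-step : ∀ {m n} (s : Shrink m n) {k} → k < m → UnitStep (shℕ s k) (shℕ s (suc k))
shℕ-step {suc m} s {k} (s≤s k≤m) =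
  subst (λ i → UnitStep (toℕ (sh s i)) (shℕ s (suc k))) (sym (clamp-inject₁ k≤m))
        (≃⇒UnitStep (sh-mon s (<⇒≤ (≤̄⇒inject₁< ≤-refl))) (sh-map s (clamp m k)))

Shrink⇒IsShrinking : ∀ {m n} (s : Shrink m n) → IsShrinking m n (shℕ s)
Shrink⇒IsShrinking {m} {n} s = record
  { zero↦zero  = zero-fixed (preimage zero)
  ; top↦top    = top-hit (preimage (fromℕ n))
  ; unit-steps = shℕ-step s
  }
  where
  mono : ∀ {a b} → a ≤ b → shℕ s a ≤ shℕ s b
  mono a≤b = sh-mon s (clamp-mono m a≤b)

  preimage : ∀ j → ∃ λ k → k ≤ m × shℕ s k ≡ toℕ j
  preimage j with sh-sur s j
  ... | i , si≡j = toℕ i , toℕ≤pred[n] i , cong toℕ (trans (cong (sh s) (clamp-toℕ m i)) si≡j)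

  zero-fixed : (∃ λ k → k ≤ m × shℕ s k ≡ 0) → shℕ s 0 ≡ 0
  zero-fixed (k , _ , sk≡0) = n≤0⇒n≡0 (≤-trans (mono z≤n) (≤-reflexive sk≡0))

  top-hit : (∃ λ k → k ≤ m × shℕ s k ≡ toℕ (fromℕ n)) → shℕ s m ≡ n
  top-hit (k , k≤m , sk≡n) =
    ≤-antisym (toℕ≤pred[n] (sh s (clamp m m)))
              (≤-trans (≤-reflexive (trans (sym (toℕ-fromℕ n)) (sym sk≡n))) (mono k≤m))

IsShrinking-id : ∀ m → IsShrinking m m id
IsShrinking-id m = record { zero↦zero = refl ; top↦top = refl ; unit-steps = λ _ → inj₂ refl }

IsShrinking-⊓ : ∀ m l → IsShrinking (m + l) m (_⊓ m)
IsShrinking-⊓ m l = record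
  { zero↦zero  = refl
  ; top↦top    = m≥n⇒m⊓n≡n (m≤m+n m l)
  ; unit-steps = λ {k} _ → unit-step k
  }
  where
  unit-step : ∀ k → UnitStep (k ⊓ m) (suc k ⊓ m)
  unit-step k with <-≤-connex k m
  ... | inj₁ k<m = inj₂ (trans (m≤n⇒m⊓n≡m k<m) (cong suc (sym (m≤n⇒m⊓n≡m (<⇒≤ k<m)))))
  ... | inj₂ m≤k = inj₁ (trans (m≥n⇒m⊓n≡n (m≤n⇒m≤1+n m≤k)) (sym (m≥n⇒m⊓n≡n m≤k)))

IsShrinking-∸ : ∀ m l → IsShrinking (m + l) l (_∸ m)
IsShrinking-∸ m l = record
  { zero↦zero  = 0∸n≡0 m
  ; top↦top    = m+n∸m≡n m l
  ; unit-steps = λ {k} _ → unit-step k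
  }
  where
  unit-step : ∀ k → UnitStep (k ∸ m) (suc k ∸ m)
  unit-step k with <-≤-connex k m
  ... | inj₁ k<m = inj₁ (trans (m≤n⇒m∸n≡0 k<m) (sym (m≤n⇒m∸n≡0 (<⇒≤ k<m))))
  ... | inj₂ m≤k = inj₂ (+-∸-assoc 1 m≤k)

splice-shrinking-+ : ∀ {m₁ n₁ s₁ m₂ n₂ s₂} → IsShrinking m₁ n₁ s₁ → IsShrinking m₂ n₂ s₂
                   → ∀ t → splice m₁ s₁ ((n₁ +_) ∘ s₂) (m₁ + t) ≡ n₁ + s₂ t
splice-shrinking-+ {m₁} {n₁} {s₁} {s₂ = s₂} S₁ S₂ = splice-+ m₁ s₁ ((n₁ +_) ∘ s₂)
  (trans (top↦top S₁) (sym (trans (cong (n₁ +_) (zero↦zero S₂)) (+-identityʳ n₁))))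

IsShrinking-splice : ∀ {m₁ n₁ s₁ m₂ n₂ s₂} → IsShrinking m₁ n₁ s₁ → IsShrinking m₂ n₂ s₂
                   → IsShrinking (m₁ + m₂) (n₁ + n₂) (splice m₁ s₁ ((n₁ +_) ∘ s₂))
IsShrinking-splice {m₁} {n₁} {s₁} {m₂} {s₂ = s₂} S₁ S₂ = record
  { zero↦zero  = trans (splice-≤ {m = m₁} s₁ ((n₁ +_) ∘ s₂) z≤n) (zero↦zero S₁)
  ; top↦top    = trans (splice-shrinking-+ S₁ S₂ m₂) (cong (n₁ +_) (top↦top S₂))
  ; unit-steps = spliced-step
  }
  where
  s = splice m₁ s₁ ((n₁ +_) ∘ s₂)

  spliced-step : ∀ {k} → k < m₁ + m₂ → UnitStep (s k) (s (suc k))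
  spliced-step {k} k<m₁+m₂ with cut m₁ k
  ... | before k<m₁ =
    subst₂ UnitStep (sym (splice-≤ s₁ _ (<⇒≤ k<m₁))) (sym (splice-≤ s₁ _ k<m₁)) (unit-steps S₁ k<m₁)
  ... | after t =
    subst₂ UnitStep (sym (splice-shrinking-+ S₁ S₂ t))
           (sym (trans (cong s (sym (+-suc m₁ t))) (splice-shrinking-+ S₁ S₂ (suc t))))
           (UnitStep-+ n₁ (unit-steps S₂ (+-cancelˡ-< m₁ t m₂ k<m₁+m₂)))

record Reparametrises {X m n x x'} (s : ℕ → ℕ) (γ : Path X n x x') (δ : Path X m x x') : Set where
  constructor reparametrises
  field
    reparametrises-at : ∀ i → at δ i ≡ walk γ (s (toℕ i))

open Reparametrises

Gen-reparametrise : ∀ {X m n s x x'} → IsShrinking m n s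
                  → (γ : Path X n x x') (δ : Path X m x x') → Reparametrises s γ δ
                  → Gen X (n , γ) (m , δ)
Gen-reparametrise S γ δ δ≡γ∘s = shrink γ δ (IsShrinking⇒Shrink S) (reparametrises-at δ≡γ∘s)

reparametrises-id : ∀ {X n x x'} (γ : Path X n x x') → Reparametrises id γ γ
reparametrises-id γ = reparametrises (sym ∘ walk-toℕ γ)

reparametrises-sh : ∀ {X m n x x'} {γ : Path X n x x'} {δ : Path X m x x'} (s : Shrink m n)
                  → (∀ i → at δ i ≡ at γ (sh s i)) → Reparametrises (shℕ s) γ δ
reparametrises-sh {m = m} {n} {γ = γ} s δ≡γ∘s = reparametrises λ i →
  trans (δ≡γ∘s i) (cong (at γ) (sym (trans (clamp-toℕ n _) (cong (sh s) (clamp-toℕ m i)))))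

reparametrises-walk : ∀ {X m n s x x'} {γ : Path X n x x'} {δ : Path X m x x'}
                    → Reparametrises s γ δ → ∀ {k} → k ≤ m → walk δ k ≡ walk γ (s k)
reparametrises-walk {m = m} {s = s} {γ = γ} δ≡γ∘s {k} k≤m =
  trans (reparametrises-at δ≡γ∘s (clamp m k)) (cong (walk γ ∘ s) (toℕ-clamp k≤m))

reparametrises-∗ : ∀ {X m₁ n₁ s₁ m₂ n₂ s₂ x x' x''}
                     {γ₁ : Path X n₁ x x'} {δ₁ : Path X m₁ x x'}
                     {γ₂ : Path X n₂ x' x''} {δ₂ : Path X m₂ x' x''}
                 → IsShrinking m₁ n₁ s₁ → IsShrinking m₂ n₂ s₂
                 → Reparametrises s₁ γ₁ δ₁ → Reparametrises s₂ γ₂ δ₂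
                 → Reparametrises (splice m₁ s₁ ((n₁ +_) ∘ s₂)) (γ₁ ∗ γ₂) (δ₁ ∗ δ₂)
reparametrises-∗ {m₁ = m₁} {n₁} {s₁} {m₂} {s₂ = s₂} {γ₁ = γ₁} {δ₁} {γ₂} {δ₂} S₁ S₂ r₁ r₂ =
  reparametrises λ i → begin
    at (δ₁ ∗ δ₂) i                            ≡⟨ at-∗ δ₁ δ₂ i ⟩
    splice m₁ (walk δ₁) (walk δ₂) (toℕ i)     ≡⟨ on-splice (toℕ≤pred[n] i) ⟩
    splice n₁ (walk γ₁) (walk γ₂) (s (toℕ i)) ≡⟨ walk-∗ γ₁ γ₂ (shrinking-bounded S (toℕ≤pred[n] i)) ⟨
    walk (γ₁ ∗ γ₂) (s (toℕ i))                ∎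
  where
  s = splice m₁ s₁ ((n₁ +_) ∘ s₂)
  S = IsShrinking-splice S₁ S₂

  on-splice : ∀ {k} → k ≤ m₁ + m₂
            → splice m₁ (walk δ₁) (walk δ₂) k ≡ splice n₁ (walk γ₁) (walk γ₂) (s k)
  on-splice {k} k≤ with cut m₁ k
  ... | before k<m₁ = begin
    splice m₁ (walk δ₁) (walk δ₂) k           ≡⟨ splice-≤ _ _ (<⇒≤ k<m₁) ⟩
    walk δ₁ k                                 ≡⟨ reparametrises-walk r₁ (<⇒≤ k<m₁) ⟩
    walk γ₁ (s₁ k)                            ≡⟨ splice-≤ _ _ (shrinking-bounded S₁ (<⇒≤ k<m₁)) ⟨
    splice n₁ (walk γ₁) (walk γ₂) (s₁ k)      ≡⟨ cong (splice n₁ _ _) (splice-≤ s₁ _ (<⇒≤ k<m₁)) ⟨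
    splice n₁ (walk γ₁) (walk γ₂) (s k)       ∎
  ... | after t = begin
    splice m₁ (walk δ₁) (walk δ₂) (m₁ + t)    ≡⟨ splice-+ m₁ _ _ (walk-junction δ₁ δ₂) t ⟩
    walk δ₂ t                                 ≡⟨ reparametrises-walk r₂ (+-cancelˡ-≤ m₁ t m₂ k≤) ⟩
    walk γ₂ (s₂ t)                            ≡⟨ splice-+ n₁ _ _ (walk-junction γ₁ γ₂) (s₂ t) ⟨
    splice n₁ (walk γ₁) (walk γ₂) (n₁ + s₂ t) ≡⟨ cong (splice n₁ _ _) (splice-shrinking-+ S₁ S₂ t) ⟨
    splice n₁ (walk γ₁) (walk γ₂) (s (m₁ + t)) ∎

Gen-∗∗ʳ : ∀ {X x x' x''} {p q : Paths X x x'} (r : Paths X x' x'')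
        → Gen X p q → Gen X (p ∗∗ r) (q ∗∗ r)
Gen-∗∗ʳ (l , ρ) (shrink γ δ s δ≡γ∘s) =
  Gen-reparametrise (IsShrinking-splice (Shrink⇒IsShrinking s) (IsShrinking-id l)) (γ ∗ ρ) (δ ∗ ρ)
    (reparametrises-∗ (Shrink⇒IsShrinking s) (IsShrinking-id l)
                      (reparametrises-sh s δ≡γ∘s) (reparametrises-id ρ))
Gen-∗∗ʳ {X} (l , ρ) (adjacent {n} γ σ γ≃σ) = adjacent (γ ∗ ρ) (σ ∗ ρ) λ i →
  subst₂ (_∋_≃_ X) (sym (at-∗ γ ρ i)) (sym (at-∗ σ ρ i))
         (splice-rel (_∋_≃_ X) n (γ≃σ ∘ clamp n) (λ _ → inj₁ refl) (toℕ i))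

Gen-∗∗ˡ : ∀ {X x x' x''} {p q : Paths X x' x''} (r : Paths X x x')
        → Gen X p q → Gen X (r ∗∗ p) (r ∗∗ q)
Gen-∗∗ˡ (l , ρ) (shrink γ δ s δ≡γ∘s) =
  Gen-reparametrise (IsShrinking-splice (IsShrinking-id l) (Shrink⇒IsShrinking s)) (ρ ∗ γ) (ρ ∗ δ)
    (reparametrises-∗ (IsShrinking-id l) (Shrink⇒IsShrinking s)
                      (reparametrises-id ρ) (reparametrises-sh s δ≡γ∘s))
Gen-∗∗ˡ {X} (l , ρ) (adjacent {n} γ σ γ≃σ) = adjacent (ρ ∗ γ) (ρ ∗ σ) λ i →
  subst₂ (_∋_≃_ X) (sym (at-∗ ρ γ i)) (sym (at-∗ ρ σ i))
         (splice-rel (_∋_≃_ X) l (λ _ → inj₁ refl) (γ≃σ ∘ clamp n) (toℕ i))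

∗∗-congʳ : ∀ {X x x' x''} {p q : Paths X x x'} (r : Paths X x' x'')
         → X ⊢ p ≈ q → X ⊢ (p ∗∗ r) ≈ (q ∗∗ r)
∗∗-congʳ r = gmap (_∗∗ r) (Gen-∗∗ʳ r)

∗∗-congˡ : ∀ {X x x' x''} {p q : Paths X x' x''} (r : Paths X x x')
         → X ⊢ p ≈ q → X ⊢ (r ∗∗ p) ≈ (r ∗∗ q)
∗∗-congˡ r = gmap (r ∗∗_) (Gen-∗∗ˡ r)

Gen-map : ∀ {X Y} (f : GraphMap X Y) {x x'} {p q : Paths X x x'}
        → Gen X p q → Gen Y (mapPaths f p) (mapPaths f q)
Gen-map f (shrink γ δ s δ≡γ∘s) = shrink (mapPath f γ) (mapPath f δ) s (cong (fun f) ∘ δ≡γ∘s)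
Gen-map f (adjacent γ σ γ≃σ)   = adjacent (mapPath f γ) (mapPath f σ) (≃-map f ∘ γ≃σ)

mapPaths-cong : ∀ {X Y} (f : GraphMap X Y) {x x'} {p q : Paths X x x'}
              → X ⊢ p ≈ q → Y ⊢ mapPaths f p ≈ mapPaths f q
mapPaths-cong f = gmap (mapPaths f) (Gen-map f)

Π₁I₀-trivial : ∀ (p q : Paths (I 0) zero zero) → I 0 ⊢ p ≈ q
Π₁I₀-trivial p q = transitive (Gen (I 0)) (symmetric (Gen (I 0)) (return (from-constant p)))
                                         (return (from-constant q))
  where
  constant : Path (I 0) 0 zero zero
  constant = record { at = λ _ → zero ; step = λ () ; start = refl ; end = refl }

  Fin1-unique : ∀ (i : Fin 1) → i ≡ zero
  Fin1-unique zero = refl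

  from-constant : ∀ p → Gen (I 0) (0 , constant) p
  from-constant (n , γ) =
    Gen-reparametrise (IsShrinking-⊓ 0 n) constant γ (reparametrises (Fin1-unique ∘ at γ))

Φ-at : ∀ {X Y m l} {x x' : V X} {y y' : V Y} (σ : Path X m x x') (τ : Path Y l y y') i
     → at (proj₂ (Φ X Y ((m , σ) , (l , τ)))) i ≡ (walk σ (toℕ i ⊓ m) , walk τ (toℕ i ∸ m))
Φ-at {X} {Y} {m} {x' = x'} {y = y} σ τ i =
  trans (at-∗ (mapPath (_□ʳ_ X {Y} y) σ) (mapPath (_□ˡ_ {X} Y x') τ) i) (on-splice (toℕ i))
  where
  on-splice : ∀ k → splice m (λ k → walk σ k , y) (λ t → x' , walk τ t) k
                  ≡ (walk σ (k ⊓ m) , walk τ (k ∸ m))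
  on-splice k with cut m k
  ... | before k<m = trans (splice-≤ _ _ (<⇒≤ k<m))
      (cong₂ _,_ (sym (walk-⊓ σ k))
                 (trans (sym (walk-zero τ)) (cong (walk τ) (sym (m≤n⇒m∸n≡0 (<⇒≤ k<m))))))
  ... | after t = trans (splice-+ m _ _ (cong₂ _,_ (walk-≥ σ ≤-refl) (sym (walk-zero τ))) t)
      (cong₂ _,_ (trans (sym (walk-≥ σ (m≤m+n m t))) (sym (walk-⊓ σ (m + t))))
                 (cong (walk τ) (sym (m+n∸m≡n m t))))

Ψ∘Φ≈id : ∀ {X Y} {x x' : V X} {y y' : V Y} (σ : Paths X x x') (τ : Paths Y y y')
       → (X ⊢ proj₁ (Ψ X Y (Φ X Y (σ , τ))) ≈ σ) × (Y ⊢ proj₂ (Ψ X Y (Φ X Y (σ , τ))) ≈ τ)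
Ψ∘Φ≈id {X} {Y} (m , σ) (l , τ) =
    symmetric (Gen X) (return (Gen-reparametrise (IsShrinking-⊓ m l) σ _
                                 (reparametrises (cong proj₁ ∘ Φ-at σ τ))))
  , symmetric (Gen Y) (return (Gen-reparametrise (IsShrinking-∸ m l) τ _
                                 (reparametrises (cong proj₂ ∘ Φ-at σ τ))))

module Staircase (n : ℕ) where

  staircase : ℕ → ℕ → ℕ
  staircase j k = j ⊓ k + (k ∸ n)

  staircase-≤ : ∀ {j k} → k ≤ j → k ≤ n → staircase j k ≡ k
  staircase-≤ {k = k} k≤j k≤n =
    trans (cong₂ _+_ (m≥n⇒m⊓n≡n k≤j) (m≤n⇒m∸n≡0 k≤n)) (+-identityʳ k)

  staircase-flat : ∀ {j k} → j ≤ k → k ≤ n → staircase j k ≡ j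
  staircase-flat {j} j≤k k≤n =
    trans (cong₂ _+_ (m≤n⇒m⊓n≡m j≤k) (m≤n⇒m∸n≡0 k≤n)) (+-identityʳ j)

  staircase-beyond : ∀ {j k} → j ≤ n → n ≤ k → staircase j (suc k) ≡ suc (staircase j k)
  staircase-beyond {j} {k} j≤n n≤k = begin
    j ⊓ suc k + (suc k ∸ n) ≡⟨ cong₂ _+_ (m≤n⇒m⊓n≡m (m≤n⇒m≤1+n j≤k)) (+-∸-assoc 1 n≤k) ⟩
    j + suc (k ∸ n)         ≡⟨ +-suc j (k ∸ n) ⟩
    suc (j + (k ∸ n))       ≡⟨ cong (λ i → suc (i + (k ∸ n))) (m≤n⇒m⊓n≡m j≤k) ⟨
    suc (j ⊓ k + (k ∸ n))   ∎
    where j≤k = ≤-trans j≤n n≤k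

  staircase-≥ : ∀ {j k} → k ≤ j → staircase (suc j) k ≡ staircase j k
  staircase-≥ {k = k} k≤j =
    cong (_+ (k ∸ n)) (trans (m≥n⇒m⊓n≡n (m≤n⇒m≤1+n k≤j)) (sym (m≥n⇒m⊓n≡n k≤j)))

  staircase-< : ∀ {j k} → j < k → staircase (suc j) k ≡ suc (staircase j k)
  staircase-< {k = k} j<k =
    cong (_+ (k ∸ n)) (trans (m≤n⇒m⊓n≡m j<k) (cong suc (sym (m≤n⇒m⊓n≡m (<⇒≤ j<k)))))

  staircase-top : ∀ k → staircase n k ≡ k
  staircase-top = m⊓n+n∸m≡n n

module Homotopy {X Y : Graph} {n : ℕ} {x x' : V X} {y y' : V Y}
                (p : Path (X □ Y) n (x , y) (x' , y')) where

  open Staircase n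

  a : ℕ → V X
  a = proj₁ ∘ walk p

  b : ℕ → V Y
  b = proj₂ ∘ walk p

  a-step : ∀ k → X ∋ a k ≃ a (suc k)
  a-step = ≃-map (π₁ X Y) ∘ walk-step p

  b-step : ∀ k → Y ∋ b k ≃ b (suc k)
  b-step = ≃-map (π₂ X Y) ∘ walk-step p

  stage : ℕ → ℕ → V (X □ Y)
  stage j k = a k , b (staircase j k)

  stage-step : ∀ {j} → j ≤ n → ∀ k → (X □ Y) ∋ stage j k ≃ stage j (suc k)
  stage-step {j} j≤n k with <-≤-connex k j
  ... | inj₁ k<j =
    subst₂ (_∋_≃_ (X □ Y)) (cong (λ u → a k , b u) (sym (staircase-≤ (<⇒≤ k<j) k≤n)))
                           (cong (λ u → a (suc k) , b u) (sym (staircase-≤ k<j 1+k≤n)))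
           (walk-step p k)
    where 1+k≤n = ≤-trans k<j j≤n
          k≤n   = <⇒≤ 1+k≤n
  ... | inj₂ j≤k with <-≤-connex k n
  ...   | inj₁ k<n =
    subst₂ (_∋_≃_ (X □ Y)) (cong (λ u → a k , b u) (sym (staircase-flat j≤k (<⇒≤ k<n))))
                           (cong (λ u → a (suc k) , b u) (sym (staircase-flat (m≤n⇒m≤1+n j≤k) k<n)))
           (≃-map (_□ʳ_ X {Y} (b j)) (a-step k))
  ...   | inj₂ n≤k =
    subst₂ (_∋_≃_ (X □ Y)) (cong (_, _) (sym (cong proj₁ (walk-≥ p n≤k))))
                           (cong₂ _,_ (sym (cong proj₁ (walk-≥ p (m≤n⇒m≤1+n n≤k))))
                                      (cong b (sym (staircase-beyond j≤n n≤k))))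
           (≃-map (_□ˡ_ {X} Y x') (b-step (staircase j k)))

  stage-start : ∀ j → stage j 0 ≡ (x , y)
  stage-start j =
    trans (cong (λ u → a 0 , b u) (cong₂ _+_ (⊓-zeroʳ j) (0∸n≡0 n))) (walk-zero p)

  stage-end : ∀ j → stage j (n + n) ≡ (x' , y')
  stage-end j = cong₂ _,_ (cong proj₁ (walk-≥ p (m≤m+n n n))) (cong proj₂ (walk-≥ p n≤staircase))
    where
    n≤staircase : n ≤ staircase j (n + n)
    n≤staircase = subst (_≤ staircase j (n + n)) (m+n∸m≡n n n) (m≤n+m _ (j ⊓ (n + n)))

  homotopy : ∀ j → j ≤ n → Paths (X □ Y) (x , y) (x' , y')
  homotopy j j≤n = n + n , fromWalk (n + n) (stage j) (stage-step j≤n) (stage-start j) (stage-end j)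

  homotopy-adjacent : ∀ {j} (j<n : j < n)
                    → Gen (X □ Y) (homotopy j (<⇒≤ j<n)) (homotopy (suc j) j<n)
  homotopy-adjacent {j} j<n = adjacent _ _ (pointwise ∘ toℕ)
    where
    pointwise : ∀ k → (X □ Y) ∋ stage j k ≃ stage (suc j) k
    pointwise k with ≤-<-connex k j
    ... | inj₁ k≤j = inj₁ (cong (λ u → a k , b u) (sym (staircase-≥ k≤j)))
    ... | inj₂ j<k = subst (λ u → (X □ Y) ∋ stage j k ≃ (a k , b u)) (sym (staircase-< j<k))
                           (≃-map (_□ˡ_ {X} Y (a k)) (b-step (staircase j k)))

  homotopy-chain : ∀ j (j≤n : j ≤ n) → (X □ Y) ⊢ homotopy 0 z≤n ≈ homotopy j j≤n
  homotopy-chain zero    z≤n = ε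
  homotopy-chain (suc j) j<n =
    transitive (Gen (X □ Y)) (homotopy-chain j (<⇒≤ j<n)) (return (homotopy-adjacent j<n))

  Φ∘Ψ-adjacent-homotopy₀ : Gen (X □ Y) (Φ X Y (Ψ X Y (n , p))) (homotopy 0 z≤n)
  Φ∘Ψ-adjacent-homotopy₀ = adjacent _ _ λ i →
    inj₁ (trans (Φ-at (mapPath (π₁ X Y) p) (mapPath (π₂ X Y) p) i)
                (cong (_, b (toℕ i ∸ n)) (cong proj₁ (walk-⊓ p (toℕ i)))))

  homotopy-top-reparametrises : Reparametrises (_⊓ n) p (proj₂ (homotopy n ≤-refl))
  homotopy-top-reparametrises = reparametrises λ i →
    trans (cong (λ u → a (toℕ i) , b u) (staircase-top (toℕ i))) (sym (walk-⊓ p (toℕ i)))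

Φ∘Ψ≈id : ∀ {X Y} {x x' : V X} {y y' : V Y} (p : Paths (X □ Y) (x , y) (x' , y'))
       → (X □ Y) ⊢ Φ X Y (Ψ X Y p) ≈ p
Φ∘Ψ≈id {X} {Y} (n , p) =
  transitive G (return Φ∘Ψ-adjacent-homotopy₀) (transitive G (homotopy-chain n ≤-refl)
    (symmetric G (return (Gen-reparametrise (IsShrinking-⊓ n n) p _ homotopy-top-reparametrises))))
  where
  G = Gen (X □ Y)
  open Homotopy p

theorem3p10 :
  -- unit: Π₁ I₀ is the terminal groupoid (one object, all morphisms equal)
  (∀ (p q : Paths (I 0) zero zero) → I 0 ⊢ p ≈ q)
  ×
  (∀ (X Y : Graph) {x x' : V X} {y y' : V Y} →
    -- Ψ is well defined on Π₁(X □ Y)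
    (∀ {p q : Paths (X □ Y) (x , y) (x' , y')} → (X □ Y) ⊢ p ≈ q →
        (X ⊢ proj₁ (Ψ X Y p) ≈ proj₁ (Ψ X Y q))
      × (Y ⊢ proj₂ (Ψ X Y p) ≈ proj₂ (Ψ X Y q)))
    ×
    -- Φ is well defined on Π₁X × Π₁Y
    (∀ {σ σ' : Paths X x x'} {τ τ' : Paths Y y y'} →
        X ⊢ σ ≈ σ' → Y ⊢ τ ≈ τ' →
        (X □ Y) ⊢ Φ X Y (σ , τ) ≈ Φ X Y (σ' , τ'))
    ×
    -- Ψ ∘ Φ = id
    (∀ (σ : Paths X x x') (τ : Paths Y y y') →
        (X ⊢ proj₁ (Ψ X Y (Φ X Y (σ , τ))) ≈ σ)
      × (Y ⊢ proj₂ (Ψ X Y (Φ X Y (σ , τ))) ≈ τ))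
    ×
    -- Φ ∘ Ψ = id
    (∀ (p : Paths (X □ Y) (x , y) (x' , y')) →
        (X □ Y) ⊢ Φ X Y (Ψ X Y p) ≈ p))
theorem3p10 = Π₁I₀-trivial , λ X Y {x} {x'} {y} {y'} →
    (λ p≈q → mapPaths-cong (π₁ X Y) p≈q , mapPaths-cong (π₂ X Y) p≈q)
  , (λ {σ} {σ'} {τ} σ≈σ' τ≈τ' → transitive (Gen (X □ Y))
        (∗∗-congʳ (mapPaths (_□ˡ_ {X} Y x') τ) (mapPaths-cong (_□ʳ_ X {Y} y) σ≈σ'))
        (∗∗-congˡ (mapPaths (_□ʳ_ X {Y} y) σ') (mapPaths-cong (_□ˡ_ {X} Y x') τ≈τ')))
  , Ψ∘Φ≈id
  , Φ∘Ψ≈id
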